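{- Let $F(t,X)\in\mathbb{F}_2[t,X]$ be symmetric in $t$ and $X$, i.e. $F(t,X)=F(X,t)$, and suppose that for some integer $m\ge1$ the equation $F(t,X)=0$, regarded as an equation in $X$ over $\mathbb{F}_2((t))$, has exactly one solution $\sigma\in\mathcal{N}(\mathbb{F}_2)$ of the form $\sigma=t+t^{m+1}+O(t^{m+2})$. Then $\sigma$ has order $2$ in $\mathcal{N}(\mathbb{F}_2)$.
   Context: $\mathcal{N}(\mathbb{F}_2)$ is the group of power series $t+a_2t^2+\cdots\in\mathbb{F}_2[[t]]$ under composition. -}

module Defs where

open import Data.Bool using (Bool; true; false; _∧_; _xor_)
open import Data.Nat using (ℕ; zero; suc; _∸_; _≤_; _<_; _≡ᵇ_)
open import Data.Product using (_×_)
open import Data.Sum using (_⊎_)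
open import Relation.Binary.PropositionalEquality using (_≡_)
open import Relation.Nullary using (¬_)

-- Formal power series over 𝔽₂ = Bool (xor = +, ∧ = ·), as coefficient functions.
PS : Set
PS = ℕ → Bool

_≈ₚ_ : PS → PS → Set
f ≈ₚ g = ∀ n → f n ≡ g n

sumTo : ℕ → (ℕ → Bool) → Bool
sumTo zero    f = f 0
sumTo (suc n) f = sumTo n f xor f (suc n)

zeroPS : PS
zeroPS _ = false

onePS : PS
onePS n = n ≡ᵇ 0

tPS : PS
tPS n = n ≡ᵇ 1

mulPS : PS → PS → PS
mulPS f g n = sumTo n (λ i → f i ∧ g (n ∸ i))

powPS : PS → ℕ → PS
powPS f zero    = onePS
powPS f (suc k) = mulPS (powPS f k) f

-- composition σ ∘ τ = σ(τ(t)), for τ with zero constant term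
-- (then τ^k = O(t^k), so the n-th coefficient only involves k ≤ n)
compose : PS → PS → PS
compose σ τ n = sumTo n (λ k → σ k ∧ powPS τ k n)

InN : PS → Set
InN σ = (σ 0 ≡ false) × (σ 1 ≡ true)

HasForm : ℕ → PS → Set
HasForm m σ = (σ 0 ≡ false) × (σ 1 ≡ true)
            × (∀ k → 2 ≤ k → k ≤ m → σ k ≡ false) × (σ (suc m) ≡ true)

-- Polynomials in 𝔽₂[t,X]: coefficient of t^i X^j, zero outside i,j ≤ bound
record Poly2 : Set where
  field
    bound   : ℕ
    coeff   : ℕ → ℕ → Bool
    support : ∀ i j → (bound < i ⊎ bound < j) → coeff i j ≡ false
open Poly2 public

Symmetric : Poly2 → Set
Symmetric F = ∀ i j → coeff F i j ≡ coeff F j i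

evalAt : Poly2 → PS → PS
evalAt F σ n = sumTo (bound F) (λ i → sumTo (bound F) (λ j →
                 coeff F i j ∧ mulPS (powPS tPS i) (powPS σ j) n))

IsRoot : Poly2 → PS → Set
IsRoot F σ = evalAt F σ ≈ₚ zeroPS

HasOrder2 : PS → Set
HasOrder2 σ = (compose σ σ ≈ₚ tPS) × ¬ (σ ≈ₚ tPS)

{-# OPTIONS --safe #-}
-- Composition f ↦ f ∘ σ with σ ∈ 𝒩(𝔽₂) is a ring endomorphism of 𝔽₂[[t]] sending t to σ,
-- and it is injective because σ^n = t^n + O(t^{n+1}). Solving τ ∘ σ = t degree by degree
-- gives a left inverse τ, which in characteristic 2 again has the form t + t^{m+1} + O(t^{m+2}).
-- Composing F(t, τ) with σ gives F(σ, t) = F(t, σ) = 0 by symmetry, so by injectivity τ is a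
-- root of F as well. Uniqueness forces τ = σ, i.e. σ ∘ σ = t, while σ ≠ t as σ_{m+1} = 1.
module Submission where

open import Defs
open import Algebra.Bundles using (CommutativeMonoid; CommutativeRing)
open import Data.Bool using (Bool; true; false; _∧_; _xor_; if_then_else_)
open import Data.Bool.Properties
  using (∧-assoc; ∧-comm; ∧-zeroʳ; ∧-identityʳ; ∧-distribˡ-xor; ∧-distribʳ-xor;
         xor-assoc; xor-same; xor-identityʳ; ∧-commutativeMonoid; xor-∧-commutativeRing)
open import Data.Nat using (ℕ; zero; suc; _+_; _∸_; _≤_; _<_; _≡ᵇ_; z≤n; s≤s; _<?_; _≤?_)
open import Data.Nat.Induction using (<-rec)
open import Data.Nat.Properties
  using (_≟_; ≤-refl; ≤-trans; ≤-pred; <⇒≤; <⇒≢; >⇒≢; <⇒≱; ≰⇒>; ≮⇒≥; ≤∧≢⇒<; <-cmp; n≤1+n;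
         m≤n⇒m≤1+n; m≤n⇒m<n∨m≡n; m≤m+n; m∸n≤m; m≤n⇒m∸n≡0; m+n∸m≡n; m+n∸n≡m; m+[n∸m]≡n;
         +-comm; +-assoc; +-identityʳ; +-suc)
open import Data.Product using (_,_)
open import Data.Sum using (inj₁; inj₂)
open import Function using (_∘_)
open import Relation.Binary.Definitions using (tri<; tri≈; tri>)
open import Relation.Binary.PropositionalEquality
open import Relation.Nullary using (¬_; yes; no; contradiction)
open import Relation.Nullary.Decidable using (dec-true; dec-false)
open import Algebra.Properties.CommutativeSemigroup (CommutativeRing.+-commutativeSemigroup xor-∧-commutativeRing)
  using () renaming (interchange to xor-interchange)
open import Algebra.Properties.CommutativeSemigroup (CommutativeMonoid.commutativeSemigroup ∧-commutativeMonoid)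
  using (x∙yz≈y∙xz) renaming (interchange to ∧-interchange)
open import Algebra.Solver.CommutativeMonoid ∧-commutativeMonoid using (solve; _⊕_; _⊜_)
open ≡-Reasoning

≡ᵇ-refl : ∀ n → (n ≡ᵇ n) ≡ true
≡ᵇ-refl n = dec-true (n ≟ n) refl

≢⇒≡ᵇ-false : ∀ m n → m ≢ n → (m ≡ᵇ n) ≡ false
≢⇒≡ᵇ-false m n = dec-false (m ≟ n)

xor≡false⇒≡ : ∀ x y → x xor y ≡ false → x ≡ y
xor≡false⇒≡ false false _ = refl
xor≡false⇒≡ true  true  _ = refl

sumTo-cong≤ : ∀ n {f g : ℕ → Bool} → (∀ k → k ≤ n → f k ≡ g k) → sumTo n f ≡ sumTo n g
sumTo-cong≤ zero    f≡g = f≡g 0 z≤n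
sumTo-cong≤ (suc n) f≡g =
  cong₂ _xor_ (sumTo-cong≤ n (λ k k≤n → f≡g k (m≤n⇒m≤1+n k≤n))) (f≡g (suc n) ≤-refl)

sumTo-cong : ∀ n {f g : ℕ → Bool} → (∀ k → f k ≡ g k) → sumTo n f ≡ sumTo n g
sumTo-cong n f≡g = sumTo-cong≤ n (λ k _ → f≡g k)

sumTo-false : ∀ n {f : ℕ → Bool} → (∀ k → k ≤ n → f k ≡ false) → sumTo n f ≡ false
sumTo-false zero    f≡false = f≡false 0 z≤n
sumTo-false (suc n) f≡false =
  cong₂ _xor_ (sumTo-false n (λ k k≤n → f≡false k (m≤n⇒m≤1+n k≤n))) (f≡false (suc n) ≤-refl)

sumTo-truncate : ∀ {n N} {f : ℕ → Bool} → n ≤ N → (∀ k → n < k → k ≤ N → f k ≡ false) →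
                 sumTo N f ≡ sumTo n f
sumTo-truncate {N = N} n≤N f≡false with m≤n⇒m<n∨m≡n n≤N
... | inj₂ refl = refl
sumTo-truncate {n} {suc N} {f} n≤N f≡false | inj₁ n<1+N = begin
    sumTo N f xor f (suc N)
  ≡⟨ cong₂ _xor_ (sumTo-truncate (≤-pred n<1+N) (λ k n<k k≤N → f≡false k n<k (m≤n⇒m≤1+n k≤N)))
                 (f≡false (suc N) n<1+N ≤-refl) ⟩
    sumTo n f xor false
  ≡⟨ xor-identityʳ _ ⟩
    sumTo n f ∎

sumTo-single : ∀ N {f : ℕ → Bool} a → a ≤ N → (∀ k → k ≤ N → k ≢ a → f k ≡ false) →
               sumTo N f ≡ f a
sumTo-single N {f} a a≤N f≡false = begin
    sumTo N f  ≡⟨ sumTo-truncate a≤N (λ k a<k k≤N → f≡false k k≤N (>⇒≢ a<k)) ⟩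
    sumTo a f  ≡⟨ last a (λ k k<a → f≡false k (≤-trans (<⇒≤ k<a) a≤N) (<⇒≢ k<a)) ⟩
    f a        ∎
  where
  last : ∀ a → (∀ k → k < a → f k ≡ false) → sumTo a f ≡ f a
  last zero    _       = refl
  last (suc a) f≡false = cong (_xor f (suc a)) (sumTo-false a (λ k k≤a → f≡false k (s≤s k≤a)))

sumTo-≡ᵇ : ∀ N x (P : ℕ → Bool) → (N < x → P x ≡ false) → sumTo N (λ a → (x ≡ᵇ a) ∧ P a) ≡ P x
sumTo-≡ᵇ N x P P≡false with x ≤? N
... | yes x≤N = trans (sumTo-single N x x≤N (λ k _ k≢x → cong (_∧ P k) (≢⇒≡ᵇ-false x k (k≢x ∘ sym))))
                      (cong (_∧ P x) (≡ᵇ-refl x))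
... | no x≰N = trans (sumTo-false N (λ k k≤N → cong (_∧ P k) (≢⇒≡ᵇ-false x k (λ { refl → x≰N k≤N }))))
                     (sym (P≡false (≰⇒> x≰N)))

sumTo-xor : ∀ n (f g : ℕ → Bool) → sumTo n (λ k → f k xor g k) ≡ sumTo n f xor sumTo n g
sumTo-xor zero    f g = refl
sumTo-xor (suc n) f g =
  trans (cong (_xor (f (suc n) xor g (suc n))) (sumTo-xor n f g))
        (xor-interchange (sumTo n f) (sumTo n g) (f (suc n)) (g (suc n)))

∧-distribˡ-sumTo : ∀ n a (f : ℕ → Bool) → a ∧ sumTo n f ≡ sumTo n (λ k → a ∧ f k)
∧-distribˡ-sumTo zero    a f = refl
∧-distribˡ-sumTo (suc n) a f =
  trans (∧-distribˡ-xor a (sumTo n f) (f (suc n))) (cong (_xor (a ∧ f (suc n))) (∧-distribˡ-sumTo n a f))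

∧-distribʳ-sumTo : ∀ n a (f : ℕ → Bool) → sumTo n f ∧ a ≡ sumTo n (λ k → f k ∧ a)
∧-distribʳ-sumTo zero    a f = refl
∧-distribʳ-sumTo (suc n) a f =
  trans (∧-distribʳ-xor a (sumTo n f) (f (suc n))) (cong (_xor (f (suc n) ∧ a)) (∧-distribʳ-sumTo n a f))

sumTo-swap : ∀ n m (f : ℕ → ℕ → Bool) →
             sumTo n (λ i → sumTo m (f i)) ≡ sumTo m (λ j → sumTo n (λ i → f i j))
sumTo-swap zero    m f = refl
sumTo-swap (suc n) m f =
  trans (cong (_xor sumTo m (f (suc n))) (sumTo-swap n m f))
        (sym (sumTo-xor m (λ j → sumTo n (λ i → f i j)) (f (suc n))))

mulPS-cong≤ : ∀ {f f′ g g′} n → (∀ k → k ≤ n → f k ≡ f′ k) → (∀ k → k ≤ n → g k ≡ g′ k) →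
              mulPS f g n ≡ mulPS f′ g′ n
mulPS-cong≤ n f≡f′ g≡g′ = sumTo-cong≤ n (λ i i≤n → cong₂ _∧_ (f≡f′ i i≤n) (g≡g′ (n ∸ i) (m∸n≤m n i)))

mulPS-cong : ∀ {f f′ g g′} → f ≈ₚ f′ → g ≈ₚ g′ → mulPS f g ≈ₚ mulPS f′ g′
mulPS-cong f≈f′ g≈g′ n = mulPS-cong≤ n (λ k _ → f≈f′ k) (λ k _ → g≈g′ k)

powPS-cong : ∀ {f g} → f ≈ₚ g → ∀ k → powPS f k ≈ₚ powPS g k
powPS-cong f≈g zero    n = refl
powPS-cong f≈g (suc k)   = mulPS-cong (powPS-cong f≈g k) f≈g

compose-congˡ : ∀ {f g} σ → f ≈ₚ g → compose f σ ≈ₚ compose g σ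
compose-congˡ σ f≈g n = sumTo-cong n (λ k → cong (_∧ powPS σ k n) (f≈g k))

mulPS-square : ∀ f g {n} N → n ≤ N →
               mulPS f g n ≡ sumTo N (λ i → sumTo N (λ j → (i + j ≡ᵇ n) ∧ (f i ∧ g j)))
mulPS-square f g {n} N n≤N = sym (begin
    sumTo N (λ i → sumTo N (row i))
  ≡⟨ sumTo-truncate n≤N (λ i n<i _ → row-outside i n<i) ⟩
    sumTo n (λ i → sumTo N (row i))
  ≡⟨ sumTo-cong≤ n row-inside ⟩
    mulPS f g n ∎)
  where
  row : ℕ → ℕ → Bool
  row i j = (i + j ≡ᵇ n) ∧ (f i ∧ g j)
  row-inside : ∀ i → i ≤ n → sumTo N (row i) ≡ f i ∧ g (n ∸ i)
  row-inside i i≤n = trans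
    (sumTo-single N (n ∸ i) (≤-trans (m∸n≤m n i) n≤N)
      (λ j _ j≢n∸i → cong (_∧ (f i ∧ g j))
        (≢⇒≡ᵇ-false (i + j) n (λ i+j≡n → j≢n∸i (trans (sym (m+n∸m≡n i j)) (cong (_∸ i) i+j≡n))))))
    (cong (_∧ (f i ∧ g (n ∸ i))) (trans (cong (_≡ᵇ n) (m+[n∸m]≡n i≤n)) (≡ᵇ-refl n)))
  row-outside : ∀ i → n < i → sumTo N (row i) ≡ false
  row-outside i n<i = sumTo-false N (λ j _ → cong (_∧ (f i ∧ g j))
    (≢⇒≡ᵇ-false (i + j) n (λ i+j≡n → <⇒≱ n<i (subst (i ≤_) i+j≡n (m≤m+n i j)))))

mulPS-comm : ∀ f g → mulPS f g ≈ₚ mulPS g f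
mulPS-comm f g n = begin
    mulPS f g n
  ≡⟨ mulPS-square f g n ≤-refl ⟩
    sumTo n (λ i → sumTo n (λ j → (i + j ≡ᵇ n) ∧ (f i ∧ g j)))
  ≡⟨ sumTo-swap n n _ ⟩
    sumTo n (λ j → sumTo n (λ i → (i + j ≡ᵇ n) ∧ (f i ∧ g j)))
  ≡⟨ sumTo-cong n (λ j → sumTo-cong n (λ i →
       cong₂ _∧_ (cong (_≡ᵇ n) (+-comm i j)) (∧-comm (f i) (g j)))) ⟩
    sumTo n (λ j → sumTo n (λ i → (j + i ≡ᵇ n) ∧ (g j ∧ f i)))
  ≡⟨ mulPS-square g f n ≤-refl ⟨
    mulPS g f n ∎

mulPS-identityˡ : ∀ f → mulPS onePS f ≈ₚ f
mulPS-identityˡ f n = sumTo-single n 0 z≤n (λ k _ k≢0 → cong (_∧ f (n ∸ k)) (≢⇒≡ᵇ-false k 0 k≢0))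

mulPS-identityʳ : ∀ f → mulPS f onePS ≈ₚ f
mulPS-identityʳ f n = trans (mulPS-comm f onePS n) (mulPS-identityˡ f n)

sumTo-mulPS-∧ : ∀ N f g (h : ℕ → Bool) → (∀ k → N < k → h k ≡ false) →
                sumTo N (λ k → mulPS f g k ∧ h k) ≡ sumTo N (λ i → sumTo N (λ j → (f i ∧ g j) ∧ h (i + j)))
sumTo-mulPS-∧ N f g h h≡false = begin
    sumTo N (λ k → mulPS f g k ∧ h k)
  ≡⟨ sumTo-cong≤ N (λ k k≤N → cong (_∧ h k) (mulPS-square f g N k≤N)) ⟩
    sumTo N (λ k → sumTo N (λ i → sumTo N (λ j → (i + j ≡ᵇ k) ∧ (f i ∧ g j))) ∧ h k)
  ≡⟨ sumTo-cong N (λ k → trans (∧-distribʳ-sumTo N (h k) _)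
                                (sumTo-cong N (λ i → ∧-distribʳ-sumTo N (h k) _))) ⟩
    sumTo N (λ k → sumTo N (λ i → sumTo N (λ j → ((i + j ≡ᵇ k) ∧ (f i ∧ g j)) ∧ h k)))
  ≡⟨ trans (sumTo-swap N N _) (sumTo-cong N (λ i → sumTo-swap N N _)) ⟩
    sumTo N (λ i → sumTo N (λ j → sumTo N (λ k → ((i + j ≡ᵇ k) ∧ (f i ∧ g j)) ∧ h k)))
  ≡⟨ sumTo-cong N (λ i → sumTo-cong N (λ j → collapse i j)) ⟩
    sumTo N (λ i → sumTo N (λ j → (f i ∧ g j) ∧ h (i + j))) ∎
  where
  collapse : ∀ i j → sumTo N (λ k → ((i + j ≡ᵇ k) ∧ (f i ∧ g j)) ∧ h k) ≡ (f i ∧ g j) ∧ h (i + j)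
  collapse i j = trans (sumTo-cong N (λ k → ∧-assoc (i + j ≡ᵇ k) (f i ∧ g j) (h k)))
    (sumTo-≡ᵇ N (i + j) (λ k → (f i ∧ g j) ∧ h k)
      (λ N<i+j → trans (cong ((f i ∧ g j) ∧_) (h≡false (i + j) N<i+j)) (∧-zeroʳ (f i ∧ g j))))

mulPS-mulPS-expand : ∀ f g h n →
  mulPS (mulPS f g) h n ≡ sumTo n (λ c → sumTo n (λ i → sumTo n (λ j → (f i ∧ g j) ∧ ((i + j + c ≡ᵇ n) ∧ h c))))
mulPS-mulPS-expand f g h n = begin
    mulPS (mulPS f g) h n
  ≡⟨ mulPS-square (mulPS f g) h n ≤-refl ⟩
    sumTo n (λ a → sumTo n (λ c → (a + c ≡ᵇ n) ∧ (mulPS f g a ∧ h c)))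
  ≡⟨ sumTo-swap n n _ ⟩
    sumTo n (λ c → sumTo n (λ a → (a + c ≡ᵇ n) ∧ (mulPS f g a ∧ h c)))
  ≡⟨ sumTo-cong n (λ c → sumTo-cong n (λ a → x∙yz≈y∙xz (a + c ≡ᵇ n) (mulPS f g a) (h c))) ⟩
    sumTo n (λ c → sumTo n (λ a → mulPS f g a ∧ ((a + c ≡ᵇ n) ∧ h c)))
  ≡⟨ sumTo-cong n (λ c → sumTo-mulPS-∧ n f g (λ a → (a + c ≡ᵇ n) ∧ h c) (λ a n<a →
       cong (_∧ h c) (≢⇒≡ᵇ-false (a + c) n (λ a+c≡n → <⇒≱ n<a (subst (a ≤_) a+c≡n (m≤m+n a c)))))) ⟩
    sumTo n (λ c → sumTo n (λ i → sumTo n (λ j → (f i ∧ g j) ∧ ((i + j + c ≡ᵇ n) ∧ h c)))) ∎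

-- f (g h) = (g h) f, whose expansion is that of (f g) h with the factors relabelled cyclically.
mulPS-assoc : ∀ f g h → mulPS (mulPS f g) h ≈ₚ mulPS f (mulPS g h)
mulPS-assoc f g h n = begin
    mulPS (mulPS f g) h n
  ≡⟨ mulPS-mulPS-expand f g h n ⟩
    sumTo n (λ c → sumTo n (λ i → sumTo n (λ j → (f i ∧ g j) ∧ ((i + j + c ≡ᵇ n) ∧ h c))))
  ≡⟨ trans (sumTo-swap n n _) (sumTo-cong n (λ i → sumTo-swap n n _)) ⟩
    sumTo n (λ i → sumTo n (λ j → sumTo n (λ c → (f i ∧ g j) ∧ ((i + j + c ≡ᵇ n) ∧ h c))))
  ≡⟨ sumTo-cong n (λ i → sumTo-cong n (λ j → sumTo-cong n (λ c → rotate i j c))) ⟩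
    sumTo n (λ i → sumTo n (λ j → sumTo n (λ c → (g j ∧ h c) ∧ ((j + c + i ≡ᵇ n) ∧ f i))))
  ≡⟨ mulPS-mulPS-expand g h f n ⟨
    mulPS (mulPS g h) f n
  ≡⟨ mulPS-comm (mulPS g h) f n ⟩
    mulPS f (mulPS g h) n ∎
  where
  rotate : ∀ i j c → (f i ∧ g j) ∧ ((i + j + c ≡ᵇ n) ∧ h c) ≡ (g j ∧ h c) ∧ ((j + c + i ≡ᵇ n) ∧ f i)
  rotate i j c rewrite +-assoc i j c | +-comm i (j + c) =
    solve 4 (λ x y b z → (x ⊕ y) ⊕ (b ⊕ z) ⊜ (y ⊕ z) ⊕ (b ⊕ x)) refl (f i) (g j) (j + c + i ≡ᵇ n) (h c)

powPS-+ : ∀ f i j → powPS f (i + j) ≈ₚ mulPS (powPS f i) (powPS f j)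
powPS-+ f i zero    n rewrite +-identityʳ i = sym (mulPS-identityʳ (powPS f i) n)
powPS-+ f i (suc j) n rewrite +-suc i j =
  trans (mulPS-cong {g = f} (powPS-+ f i j) (λ _ → refl) n) (mulPS-assoc (powPS f i) (powPS f j) f n)

mulPS-sumTo : ∀ N (F G : ℕ → PS) n →
  mulPS (λ a → sumTo N (λ i → F i a)) (λ b → sumTo N (λ j → G j b)) n ≡
  sumTo N (λ i → sumTo N (λ j → mulPS (F i) (G j) n))
mulPS-sumTo N F G n = begin
    sumTo n (λ a → sumTo N (λ i → F i a) ∧ sumTo N (λ j → G j (n ∸ a)))
  ≡⟨ sumTo-cong n (λ a → trans (∧-distribʳ-sumTo N _ _) (sumTo-cong N (λ i → ∧-distribˡ-sumTo N _ _))) ⟩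
    sumTo n (λ a → sumTo N (λ i → sumTo N (λ j → F i a ∧ G j (n ∸ a))))
  ≡⟨ trans (sumTo-swap n N _) (sumTo-cong N (λ i → sumTo-swap n N _)) ⟩
    sumTo N (λ i → sumTo N (λ j → mulPS (F i) (G j) n)) ∎

mulPS-∧ : ∀ x y (p q : PS) n → mulPS (λ a → x ∧ p a) (λ b → y ∧ q b) n ≡ (x ∧ y) ∧ mulPS p q n
mulPS-∧ x y p q n =
  trans (sumTo-cong n (λ a → ∧-interchange x (p a) y (q (n ∸ a)))) (sym (∧-distribˡ-sumTo n (x ∧ y) _))

compose-sumTo : ∀ N (H : ℕ → PS) σ n →
                compose (λ k → sumTo N (λ i → H i k)) σ n ≡ sumTo N (λ i → compose (H i) σ n)
compose-sumTo N H σ n =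
  trans (sumTo-cong n (λ k → ∧-distribʳ-sumTo N (powPS σ k n) _)) (sumTo-swap n N _)

compose-∧ : ∀ x (H : PS) σ n → compose (λ k → x ∧ H k) σ n ≡ x ∧ compose H σ n
compose-∧ x H σ n =
  trans (sumTo-cong n (λ k → ∧-assoc x (H k) (powPS σ k n))) (sym (∧-distribˡ-sumTo n x _))

compose-onePS : ∀ σ → compose onePS σ ≈ₚ onePS
compose-onePS σ n = sumTo-single n 0 z≤n (λ k _ k≢0 → cong (_∧ powPS σ k n) (≢⇒≡ᵇ-false k 0 k≢0))

module Substitution {σ : PS} (σ₀ : σ 0 ≡ false) where

  powPS-vanish : ∀ k {n} → n < k → powPS σ k n ≡ false
  powPS-vanish (suc k) {n} (s≤s n≤k) = sumTo-false n term
    where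
    term : ∀ i → i ≤ n → powPS σ k i ∧ σ (n ∸ i) ≡ false
    term i _ with i <? k
    ... | yes i<k = cong (_∧ σ (n ∸ i)) (powPS-vanish k i<k)
    ... | no  i≮k = begin
      powPS σ k i ∧ σ (n ∸ i)  ≡⟨ cong (λ j → powPS σ k i ∧ σ j) (m≤n⇒m∸n≡0 (≤-trans n≤k (≮⇒≥ i≮k))) ⟩
      powPS σ k i ∧ σ 0        ≡⟨ cong (powPS σ k i ∧_) σ₀ ⟩
      powPS σ k i ∧ false      ≡⟨ ∧-zeroʳ _ ⟩
      false                    ∎

  compose-extend : ∀ f {n} N → n ≤ N → compose f σ n ≡ sumTo N (λ k → f k ∧ powPS σ k n)
  compose-extend f N n≤N = sym (sumTo-truncate n≤N
    (λ k n<k _ → trans (cong (f k ∧_) (powPS-vanish k n<k)) (∧-zeroʳ (f k))))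

  compose-tPS : compose tPS σ ≈ₚ σ
  compose-tPS n = begin
      compose tPS σ n
    ≡⟨ compose-extend tPS (suc n) (n≤1+n n) ⟩
      sumTo (suc n) (λ k → tPS k ∧ powPS σ k n)
    ≡⟨ sumTo-single (suc n) 1 (s≤s z≤n) (λ k _ k≢1 → cong (_∧ powPS σ k n) (≢⇒≡ᵇ-false k 1 k≢1)) ⟩
      mulPS onePS σ n
    ≡⟨ mulPS-identityˡ σ n ⟩
      σ n ∎

  compose-mulPS : ∀ f g → compose (mulPS f g) σ ≈ₚ mulPS (compose f σ) (compose g σ)
  compose-mulPS f g n = begin
      compose (mulPS f g) σ n
    ≡⟨ sumTo-mulPS-∧ n f g (λ k → powPS σ k n) (λ k → powPS-vanish k) ⟩
      sumTo n (λ i → sumTo n (λ j → (f i ∧ g j) ∧ powPS σ (i + j) n))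
    ≡⟨ sumTo-cong n (λ i → sumTo-cong n (λ j → trans (cong ((f i ∧ g j) ∧_) (powPS-+ σ i j n))
                                                      (sym (mulPS-∧ (f i) (g j) (powPS σ i) (powPS σ j) n)))) ⟩
      sumTo n (λ i → sumTo n (λ j → mulPS (λ a → f i ∧ powPS σ i a) (λ b → g j ∧ powPS σ j b) n))
    ≡⟨ mulPS-sumTo n (λ i a → f i ∧ powPS σ i a) (λ j b → g j ∧ powPS σ j b) n ⟨
      mulPS (λ a → sumTo n (λ i → f i ∧ powPS σ i a)) (λ b → sumTo n (λ j → g j ∧ powPS σ j b)) n
    ≡⟨ mulPS-cong≤ n (λ a a≤n → compose-extend f n a≤n) (λ b b≤n → compose-extend g n b≤n) ⟨
      mulPS (compose f σ) (compose g σ) n ∎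

  compose-powPS : ∀ f k → compose (powPS f k) σ ≈ₚ powPS (compose f σ) k
  compose-powPS f zero        = compose-onePS σ
  compose-powPS f (suc k) n =
    trans (compose-mulPS (powPS f k) f n) (mulPS-cong {g = compose f σ} (compose-powPS f k) (λ _ → refl) n)

  compose-evalAt : ∀ F → Symmetric F → ∀ {τ} → compose τ σ ≈ₚ tPS → compose (evalAt F τ) σ ≈ₚ evalAt F σ
  compose-evalAt F F-sym {τ} τ∘σ≈t n = begin
      compose (evalAt F τ) σ n
    ≡⟨ compose-sumTo B _ σ n ⟩
      sumTo B (λ i → compose (λ k → sumTo B (λ j → coeff F i j ∧ mulPS (powPS tPS i) (powPS τ j) k)) σ n)
    ≡⟨ sumTo-cong B (λ i → trans (compose-sumTo B _ σ n) (sumTo-cong B (λ j → compose-∧ (coeff F i j) _ σ n))) ⟩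
      sumTo B (λ i → sumTo B (λ j → coeff F i j ∧ compose (mulPS (powPS tPS i) (powPS τ j)) σ n))
    ≡⟨ sumTo-cong B (λ i → sumTo-cong B (λ j → cong₂ _∧_ (F-sym i j) (substitute i j))) ⟩
      sumTo B (λ i → sumTo B (λ j → coeff F j i ∧ mulPS (powPS tPS j) (powPS σ i) n))
    ≡⟨ sumTo-swap B B _ ⟩
      evalAt F σ n ∎
    where
    B = bound F
    substitute : ∀ i j → compose (mulPS (powPS tPS i) (powPS τ j)) σ n ≡ mulPS (powPS tPS j) (powPS σ i) n
    substitute i j = begin
        compose (mulPS (powPS tPS i) (powPS τ j)) σ n
      ≡⟨ compose-mulPS (powPS tPS i) (powPS τ j) n ⟩
        mulPS (compose (powPS tPS i) σ) (compose (powPS τ j) σ) n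
      ≡⟨ mulPS-cong (λ k → trans (compose-powPS tPS i k) (powPS-cong compose-tPS i k))
                    (λ k → trans (compose-powPS τ j k) (powPS-cong τ∘σ≈t j k)) n ⟩
        mulPS (powPS σ i) (powPS tPS j) n
      ≡⟨ mulPS-comm (powPS σ i) (powPS tPS j) n ⟩
        mulPS (powPS tPS j) (powPS σ i) n ∎

module Inverse {σ : PS} (σ₀ : σ 0 ≡ false) (σ₁ : σ 1 ≡ true) where

  open Substitution {σ} σ₀

  powPS-diagonal : ∀ n → powPS σ n n ≡ true
  powPS-diagonal zero    = refl
  powPS-diagonal (suc n) = begin
      mulPS (powPS σ n) σ (suc n)
    ≡⟨ sumTo-single (suc n) n (n≤1+n n) off-diagonal ⟩
      powPS σ n n ∧ σ (suc n ∸ n)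
    ≡⟨ cong₂ _∧_ (powPS-diagonal n) (trans (cong σ (m+n∸n≡m 1 n)) σ₁) ⟩
      true ∎
    where
    off-diagonal : ∀ i → i ≤ suc n → i ≢ n → powPS σ n i ∧ σ (suc n ∸ i) ≡ false
    off-diagonal i _ i≢n with <-cmp i n
    ... | tri< i<n _ _ = cong (_∧ σ (suc n ∸ i)) (powPS-vanish n i<n)
    ... | tri≈ _ i≡n _ = contradiction i≡n i≢n
    ... | tri> _ _ n<i = trans (cong (λ j → powPS σ n i ∧ σ j) (m≤n⇒m∸n≡0 n<i))
                               (trans (cong (powPS σ n i ∧_) σ₀) (∧-zeroʳ _))

  compose≈zeroPS⇒≈zeroPS : ∀ G → compose G σ ≈ₚ zeroPS → G ≈ₚ zeroPS
  compose≈zeroPS⇒≈zeroPS G G∘σ≈0 = <-rec (λ n → G n ≡ false) step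
    where
    step : ∀ n → (∀ {k} → k < n → G k ≡ false) → G n ≡ false
    step n G<n≡0 = begin
        G n                ≡⟨ ∧-identityʳ (G n) ⟨
        G n ∧ true         ≡⟨ cong (G n ∧_) (powPS-diagonal n) ⟨
        G n ∧ powPS σ n n  ≡⟨ sumTo-single n n ≤-refl
                                (λ k k≤n k≢n → cong (_∧ powPS σ k n) (G<n≡0 (≤∧≢⇒< k≤n k≢n))) ⟨
        compose G σ n      ≡⟨ G∘σ≈0 n ⟩
        false              ∎

  -- approx n is the left inverse truncated below degree n; its new coefficient in degree n
  -- corrects the t^n coefficient of approx n ∘ σ, because σ^n = t^n + O(t^{n+1}).
  approx : ℕ → PS
  approx zero      = zeroPS
  approx (suc n) k = if k ≡ᵇ n then compose (approx n) σ n xor tPS n else approx n k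

  inverse : PS
  inverse k = approx (suc k) k

  approx-high : ∀ n {k} → n ≤ k → approx n k ≡ false
  approx-high zero    _ = refl
  approx-high (suc n) {k} n<k rewrite ≢⇒≡ᵇ-false k n (>⇒≢ n<k) = approx-high n (<⇒≤ n<k)

  approx-inverse : ∀ n {k} → k < n → approx n k ≡ inverse k
  approx-inverse (suc n) {k} k<1+n with k ≟ n
  ... | yes refl = refl
  ... | no  k≢n rewrite ≢⇒≡ᵇ-false k n k≢n = approx-inverse n (≤∧≢⇒< (≤-pred k<1+n) k≢n)

  inverse-coeff : ∀ n → inverse n ≡ compose (approx n) σ n xor tPS n
  inverse-coeff n rewrite ≡ᵇ-refl n = refl

  compose-inverse-last : ∀ n → compose inverse σ n ≡ compose (approx n) σ n xor inverse n
  compose-inverse-last zero    = refl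
  compose-inverse-last (suc n) =
    cong₂ _xor_ lower (trans (cong (inverse (suc n) ∧_) (powPS-diagonal (suc n))) (∧-identityʳ _))
    where
    lower : sumTo n (λ k → inverse k ∧ powPS σ k (suc n)) ≡ compose (approx (suc n)) σ (suc n)
    lower = begin
        sumTo n (λ k → inverse k ∧ powPS σ k (suc n))
      ≡⟨ sumTo-cong≤ n (λ k k≤n → cong (_∧ powPS σ k (suc n)) (approx-inverse (suc n) (s≤s k≤n))) ⟨
        sumTo n (λ k → approx (suc n) k ∧ powPS σ k (suc n))
      ≡⟨ xor-identityʳ _ ⟨
        sumTo n (λ k → approx (suc n) k ∧ powPS σ k (suc n)) xor false
      ≡⟨ cong (λ x → sumTo n (λ k → approx (suc n) k ∧ powPS σ k (suc n)) xor (x ∧ powPS σ (suc n) (suc n)))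
              (approx-high (suc n) ≤-refl) ⟨
        compose (approx (suc n)) σ (suc n) ∎

  compose-inverse≈tPS : compose inverse σ ≈ₚ tPS
  compose-inverse≈tPS n = begin
      compose inverse σ n        ≡⟨ compose-inverse-last n ⟩
      c xor inverse n            ≡⟨ cong (c xor_) (inverse-coeff n) ⟩
      c xor (c xor tPS n)        ≡⟨ xor-assoc c c (tPS n) ⟨
      (c xor c) xor tPS n        ≡⟨ cong (_xor tPS n) (xor-same c) ⟩
      tPS n                      ∎
    where
    c = compose (approx n) σ n

  inverse≡σ : ∀ n → (∀ {k} → k < 2 + n → 2 ≤ k → inverse k ≡ false) → inverse (2 + n) ≡ σ (2 + n)
  inverse≡σ n gap = sym (xor≡false⇒≡ (σ (2 + n)) (inverse (2 + n)) (begin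
      σ (2 + n) xor inverse (2 + n)  ≡⟨ cong₂ _xor_ degree-one diagonal ⟨
      compose inverse σ (2 + n)      ≡⟨ compose-inverse≈tPS (2 + n) ⟩
      false                          ∎))
    where
    degree-one : sumTo (suc n) (λ k → inverse k ∧ powPS σ k (2 + n)) ≡ σ (2 + n)
    degree-one = trans (sumTo-single (suc n) 1 (s≤s z≤n) higher) (mulPS-identityˡ σ (2 + n))
      where
      higher : ∀ k → k ≤ suc n → k ≢ 1 → inverse k ∧ powPS σ k (2 + n) ≡ false
      higher zero          _   _   = refl
      higher (suc zero)    _   1≢1 = contradiction refl 1≢1
      higher (suc (suc k)) k≤n _   = cong (_∧ powPS σ (2 + k) (2 + n)) (gap (s≤s k≤n) (s≤s (s≤s z≤n)))
    diagonal : inverse (2 + n) ∧ powPS σ (2 + n) (2 + n) ≡ inverse (2 + n)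
    diagonal = trans (cong (inverse (2 + n) ∧_) (powPS-diagonal (2 + n))) (∧-identityʳ _)

  inverse-hasForm : ∀ m → HasForm (suc m) σ → HasForm (suc m) inverse
  inverse-hasForm m (_ , _ , σ-gap , σ-top) = refl , refl , gap , top
    where
    gap : ∀ k → 2 ≤ k → k ≤ suc m → inverse k ≡ false
    gap = <-rec (λ k → 2 ≤ k → k ≤ suc m → inverse k ≡ false) step
      where
      step : ∀ k → (∀ {j} → j < k → 2 ≤ j → j ≤ suc m → inverse j ≡ false) →
             2 ≤ k → k ≤ suc m → inverse k ≡ false
      step (suc zero)    _    (s≤s ()) _
      step (suc (suc k)) gap< 2≤k     k≤m = trans
        (inverse≡σ k (λ j<k 2≤j → gap< j<k 2≤j (≤-trans (<⇒≤ j<k) k≤m)))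
        (σ-gap (2 + k) 2≤k k≤m)
    top : inverse (2 + m) ≡ true
    top = trans (inverse≡σ m (λ j<2+m 2≤j → gap _ 2≤j (≤-pred j<2+m))) σ-top

lemma10p8 : (F : Poly2) → Symmetric F → (m : ℕ) → 1 ≤ m →
    (σ : PS) → InN σ → HasForm m σ → IsRoot F σ →
    (∀ τ → InN τ → HasForm m τ → IsRoot F τ → τ ≈ₚ σ) →
    HasOrder2 σ
lemma10p8 F F-sym (suc m) _ σ (σ₀ , σ₁) σ-form@(_ , _ , _ , σ-top) σ-root σ-unique = σ∘σ≈t , σ≉t
  where
  open Substitution {σ} σ₀
  open Inverse {σ} σ₀ σ₁

  inverse-root : IsRoot F inverse
  inverse-root = compose≈zeroPS⇒≈zeroPS (evalAt F inverse)
    (λ n → trans (compose-evalAt F F-sym compose-inverse≈tPS n) (σ-root n))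

  inverse≈σ : inverse ≈ₚ σ
  inverse≈σ = σ-unique inverse (refl , refl) (inverse-hasForm m σ-form) inverse-root

  σ∘σ≈t : compose σ σ ≈ₚ tPS
  σ∘σ≈t n = trans (sym (compose-congˡ σ inverse≈σ n)) (compose-inverse≈tPS n)

  σ≉t : ¬ (σ ≈ₚ tPS)
  σ≉t σ≈t with () ← trans (sym σ-top) (σ≈t (2 + m))
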